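{- Let $\mathcal U$ be a saturated structure of cardinality $\kappa$, where $\kappa$ is uncountable and larger than the cardinality of the language, let $A\subseteq\mathcal U$ with $|A|<\kappa$, let $z$ be a tuple of variables of ordinal length $|z|<\kappa$, and let $G=\mathrm{Autf}(\mathcal U/A)$ act on $X=\mathcal U^{|z|}$ coordinatewise. If $\mathcal D_1,\dots,\mathcal D_n\subseteq X$ are finitely many drifting sets, then $\mathcal D_1\cup\dots\cup\mathcal D_n$ is not quasi-invariant.
   Context: "Small" means of cardinality $<\kappa$; a "model" is an elementary substructure of $\mathcal U$ of small cardinality. $\mathrm{Aut}(\mathcal U/A)$ is the group of automorphisms of $\mathcal U$ fixing $A$ pointwise, and $\mathrm{Autf}(\mathcal U/A)$ is the subgroup of $\mathrm{Aut}(\mathcal U/A)$ generated by those automorphisms that fix pointwise some model $M$ containing $A$. A set $\mathcal D\subseteq X$ is drifting if for every finitely many $f_1,\dots,f_k\in G$ there is $g\in G$ such that $g[\mathcal D]$ is disjoint from each $f_i[\mathcal D]$. A set $\mathcal D\subseteq X$ is quasi-invariant if for every finitely many $f_1,\dots,f_k\in G$ the intersection $f_1[\mathcal D]\cap\dots\cap f_k[\mathcal D]$ is non-empty. -}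

module Defs where

open import Level using (Level; _⊔_; suc)
open import Algebra.Bundles using (Group)
open import Data.Nat using (ℕ)
open import Data.Fin using (Fin)
open import Data.Product using (Σ; _×_; ∃)
open import Relation.Nullary using (¬_)
open import Relation.Binary.PropositionalEquality using (_≡_)

record Action {c ℓ : Level} (G : Group c ℓ) (x : Level) : Set (suc x ⊔ c ⊔ ℓ) where
  open Group G
  field
    X     : Set x
    act   : Carrier → X → X
    act-ε : ∀ p → act ε p ≡ p
    act-∙ : ∀ g h p → act (g ∙ h) p ≡ act g (act h p)
    act-≈ : ∀ {g h} → g ≈ h → ∀ p → act g p ≡ act h p

module _ {c ℓ x : Level} {G : Group c ℓ} (𝒜 : Action G x) where
  open Group G
  open Action 𝒜

  Subset : Set (suc x)
  Subset = X → Set x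

  img : Carrier → Subset → X → Set x
  img f D p = Σ X λ q → D q × p ≡ act f q

  ⋃ : {n : ℕ} → (Fin n → Subset) → Subset
  ⋃ {n} D p = Σ (Fin n) λ i → D i p

  Drifting : Subset → Set (c ⊔ x)
  Drifting D = (k : ℕ) (f : Fin k → Carrier) →
    Σ Carrier λ g → (i : Fin k) → (p : X) → ¬ (img g D p × img (f i) D p)

  QuasiInvariant : Subset → Set (c ⊔ x)
  QuasiInvariant D = (k : ℕ) (f : Fin k → Carrier) →
    Σ X λ p → (i : Fin k) → img (f i) D p

{-# OPTIONS --safe #-}
-- Strengthen the claim to finite unions of translates a·Dᵢ and induct on n.  Suppose
-- W ⋆ D ∪ E is quasi-invariant, where W ⋆ D is the union of the translates a·D (a ∈ W)
-- of the drifting D and E is built from the other sets, and pick g with g·D disjoint from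
-- every b·D, b ∈ W.  Take p in h·(W ⋆ D ∪ E) and in every h a g⁻¹·(W ⋆ D ∪ E).  If
-- p = h a r with r ∈ D, then g r ∈ W ⋆ D ∪ E lies in g·D, hence not in W ⋆ D, so in E and
-- p ∈ h a g⁻¹·E.  Thus E ∪ ⋃_{a ∈ W} a g⁻¹·E, a union of translates of the other sets, is
-- quasi-invariant; with no sets left the union is empty, which cannot be.
module Submission where

open import Defs
open import Level using (Level; _⊔_)
open import Algebra.Bundles using (Group)
open import Data.Nat using (ℕ; zero; suc)
open import Data.Fin using (Fin; zero; suc)
open import Data.Empty using (⊥-elim)
open import Data.Product using (∃; _×_; _,_)
open import Data.Sum using (inj₁; inj₂)
open import Data.List using (List; []; _∷_; _++_; map; length; lookup; cartesianProductWith)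
open import Data.List.Membership.Propositional using (_∈_)
open import Data.List.Membership.Propositional.Properties
  using (∈-map⁺; ∈-++⁺ˡ; ∈-++⁺ʳ; ∈-cartesianProductWith⁺)
open import Data.List.Relation.Unary.Any using (here; there; index)
open import Data.List.Relation.Unary.Any.Properties using (lookup-index)
open import Relation.Nullary using (¬_)
open import Relation.Unary using (Pred; _⊆_; _∪_; _∩_; Empty; Satisfiable) renaming (⋃ to ⋃ᵢ)
open import Relation.Binary.PropositionalEquality using (_≡_; refl; sym; trans; cong; subst; module ≡-Reasoning)

lookup⇒∈ : ∀ {a p} {A : Set a} {P : A → Set p} (xs : List A) →
           (∀ i → P (lookup xs i)) → ∀ {x} → x ∈ xs → P x
lookup⇒∈ {P = P} xs Pxs x∈xs = subst P (sym (lookup-index x∈xs)) (Pxs (index x∈xs))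

module _ {c ℓ x : Level} {G : Group c ℓ} (𝒜 : Action G x) where
  open Group G using (Carrier; _∙_; _⁻¹; ε; inverseˡ; inverseʳ)
  open Action 𝒜

  act-⁻¹-act : ∀ g p → act (g ⁻¹) (act g p) ≡ p
  act-⁻¹-act g p = trans (sym (act-∙ (g ⁻¹) g p)) (trans (act-≈ (inverseˡ g) p) (act-ε p))

  act-act-⁻¹ : ∀ g p → act g (act (g ⁻¹) p) ≡ p
  act-act-⁻¹ g p = trans (sym (act-∙ g (g ⁻¹) p)) (trans (act-≈ (inverseʳ g) p) (act-ε p))

  act-injective : ∀ g {p q} → act g p ≡ act g q → p ≡ q
  act-injective g {p} {q} gp≡gq = begin
    p                     ≡⟨ sym (act-⁻¹-act g p) ⟩
    act (g ⁻¹) (act g p)  ≡⟨ cong (act (g ⁻¹)) gp≡gq ⟩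
    act (g ⁻¹) (act g q)  ≡⟨ act-⁻¹-act g q ⟩
    q                     ∎
    where open ≡-Reasoning

  -- Agrees definitionally with img, but for predicates of every level.
  infixr 7.5 _·_ _⋆_
  _·_ : ∀ {ℓ′} → Carrier → Pred X ℓ′ → Pred X (x ⊔ ℓ′)
  (g · S) p = ∃ λ q → S q × p ≡ act g q

  _⋆_ : ∀ {ℓ′} → List Carrier → Pred X ℓ′ → Pred X (c ⊔ x ⊔ ℓ′)
  (W ⋆ S) p = ∃ λ a → a ∈ W × (a · S) p

  module _ {ℓ₁ ℓ₂} {S : Pred X ℓ₁} {T : Pred X ℓ₂} where

    ·-mono : ∀ g → S ⊆ T → g · S ⊆ g · T
    ·-mono g S⊆T (q , Sq , p≡gq) = q , S⊆T Sq , p≡gq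

    ·-∩ : ∀ g → g · S ∩ g · T ⊆ g · (S ∩ T)
    ·-∩ g ((q , Sq , p≡gq) , (q′ , Tq′ , p≡gq′)) =
      q , (Sq , subst T (act-injective g (trans (sym p≡gq′) p≡gq)) Tq′) , p≡gq

  module _ {ℓ′} {S : Pred X ℓ′} where

    ·-ε⁺ : S ⊆ ε · S
    ·-ε⁺ {p} Sp = p , Sp , sym (act-ε p)

    ·-∙⁺ : ∀ g h → g · h · S ⊆ (g ∙ h) · S
    ·-∙⁺ g h (_ , (q , Sq , refl) , p≡g[hq]) = q , Sq , trans p≡g[hq] (sym (act-∙ g h q))

    ·-∙⁻ : ∀ g h → (g ∙ h) · S ⊆ g · h · S
    ·-∙⁻ g h (q , Sq , p≡[gh]q) = act h q , (q , Sq , refl) , trans p≡[gh]q (act-∙ g h q)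

    ·⊆⋆ : ∀ {a W} → a ∈ W → a · S ⊆ W ⋆ S
    ·⊆⋆ a∈W aSp = _ , a∈W , aSp

    ∪-⋆⊆∷-⋆ : ∀ V → S ∪ V ⋆ S ⊆ (ε ∷ V) ⋆ S
    ∪-⋆⊆∷-⋆ V (inj₁ Sp)                = ·⊆⋆ (here refl) (·-ε⁺ Sp)
    ∪-⋆⊆∷-⋆ V (inj₂ (a , a∈V , aSp)) = ·⊆⋆ (there a∈V) aSp

    ⋆-⋆ : ∀ V W → V ⋆ W ⋆ S ⊆ cartesianProductWith _∙_ V W ⋆ S
    ⋆-⋆ V W (a , a∈V , q , (b , b∈W , bSq) , p≡aq) =
      ·⊆⋆ (∈-cartesianProductWith⁺ _∙_ a∈V b∈W) (·-∙⁺ a b (q , bSq , p≡aq))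

  ⋆-⋃ : ∀ {i ℓ′} {I : Set i} {F : I → Pred X ℓ′} V → V ⋆ ⋃ᵢ I F ⊆ ⋃ᵢ I (λ j → V ⋆ F j)
  ⋆-⋃ V (a , a∈V , q , (j , Fq) , p≡aq) = j , a , a∈V , q , Fq , p≡aq

  -- QuasiInvariant 𝒜, for predicates of every level and with the translates listed.
  QuasiInvariant′ : ∀ {ℓ′} → Pred X ℓ′ → Set (c ⊔ x ⊔ ℓ′)
  QuasiInvariant′ S = (H : List Carrier) → ∃ λ p → ∀ {h} → h ∈ H → (h · S) p

  quasiInvariant⇒quasiInvariant′ : ∀ {S} → QuasiInvariant 𝒜 S → QuasiInvariant′ S
  quasiInvariant⇒quasiInvariant′ qi H with qi (length H) (lookup H)
  ... | p , p∈H[S] = p , lookup⇒∈ H p∈H[S]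

  quasiInvariant′-mono : ∀ {ℓ₁ ℓ₂} {S : Pred X ℓ₁} {T : Pred X ℓ₂} →
                         S ⊆ T → QuasiInvariant′ S → QuasiInvariant′ T
  quasiInvariant′-mono S⊆T qi H with qi H
  ... | p , p∈H[S] = p , λ h∈H → ·-mono _ S⊆T (p∈H[S] h∈H)

  quasiInvariant′⇒satisfiable : ∀ {ℓ′} {S : Pred X ℓ′} → QuasiInvariant′ S → Satisfiable S
  quasiInvariant′⇒satisfiable qi with qi (ε ∷ [])
  ... | _ , p∈εS with p∈εS (here refl)
  ...   | q , Sq , _ = q , Sq

  drifting-away-from : ∀ {D} → Drifting 𝒜 D → (W : List Carrier) →
                       ∃ λ g → ∀ {b} → b ∈ W → Empty (g · D ∩ b · D)
  drifting-away-from {D} drifting W with drifting (length W) (lookup W)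
  ... | g , away = g , lookup⇒∈ {P = λ b → Empty (g · D ∩ b · D)} W away

  module _ {ℓ′} {D : Subset 𝒜} {E : Pred X ℓ′} {W : List Carrier} {g : Carrier}
           (away : ∀ {b} → b ∈ W → Empty (g · D ∩ b · D)) where

    ∩-⁻¹·-⊆ : D ∩ g ⁻¹ · (W ⋆ D ∪ E) ⊆ g ⁻¹ · E
    ∩-⁻¹·-⊆ {r} (Dr , s , W⋆D∪Es , r≡g⁻¹s) with W⋆D∪Es
    ... | inj₂ Es              = s , Es , r≡g⁻¹s
    ... | inj₁ (b , b∈W , bDs) = ⊥-elim (away b∈W s ((r , Dr , s≡gr) , bDs))
      where
      s≡gr : s ≡ act g r
      s≡gr = trans (sym (act-act-⁻¹ g s)) (cong (act g) (sym r≡g⁻¹s))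

    ·-∩-∙⁻¹·-⊆ : ∀ a → a · D ∩ (a ∙ g ⁻¹) · (W ⋆ D ∪ E) ⊆ (a ∙ g ⁻¹) · E
    ·-∩-∙⁻¹·-⊆ a (aDq , ag⁻¹Tq) =
      ·-∙⁺ a (g ⁻¹) (·-mono a ∩-⁻¹·-⊆ (·-∩ a (aDq , ·-∙⁻ a (g ⁻¹) ag⁻¹Tq)))

  quasiInvariant′-drop-drifting :
    ∀ {ℓ′} {D : Subset 𝒜} {E : Pred X ℓ′} → Drifting 𝒜 D → (W : List Carrier) →
    QuasiInvariant′ (W ⋆ D ∪ E) → ∃ λ g → QuasiInvariant′ (E ∪ map (_∙ g ⁻¹) W ⋆ E)
  quasiInvariant′-drop-drifting {E = E} drifting W qi with drifting-away-from drifting W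
  ... | g , away = g , qi′
    where
    V : List Carrier
    V = map (_∙ g ⁻¹) W

    qi′ : QuasiInvariant′ (E ∪ V ⋆ E)
    qi′ H with qi (H ++ cartesianProductWith _∙_ H V)
    ... | p , p∈H′[T] = p , p∈H[E∪V⋆E]
      where
      p∈H[E∪V⋆E] : ∀ {h} → h ∈ H → (h · (E ∪ V ⋆ E)) p
      p∈H[E∪V⋆E] {h} h∈H with p∈H′[T] (∈-++⁺ˡ h∈H)
      ... | q , inj₂ Eq , p≡hq = q , inj₁ Eq , p≡hq
      ... | q , inj₁ (a , a∈W , aDq) , p≡hq =
        ·-mono h (λ q∈ → inj₂ (·⊆⋆ (∈-map⁺ (_∙ g ⁻¹) a∈W) (·-∩-∙⁻¹·-⊆ away a q∈)))
          (·-∩ h ((q , aDq , p≡hq) , ·-∙⁻ h (a ∙ g ⁻¹) (p∈H′[T] h∙ag⁻¹∈H′)))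
        where
        h∙ag⁻¹∈H′ : h ∙ (a ∙ g ⁻¹) ∈ H ++ cartesianProductWith _∙_ H V
        h∙ag⁻¹∈H′ = ∈-++⁺ʳ H (∈-cartesianProductWith⁺ _∙_ h∈H (∈-map⁺ (_∙ g ⁻¹) a∈W))

  Translates : ∀ {n} → (Fin n → Subset 𝒜) → (Fin n → List Carrier) → Pred X (c ⊔ x)
  Translates {n} D L = ⋃ᵢ (Fin n) (λ i → L i ⋆ D i)

  ⋆-Translates : ∀ {n} {D : Fin n → Subset 𝒜} {L} V →
                 V ⋆ Translates D L ⊆ Translates D (λ i → cartesianProductWith _∙_ V (L i))
  ⋆-Translates V p∈ with ⋆-⋃ V p∈
  ... | i , p∈′ = i , ⋆-⋆ V _ p∈′

  quasiInvariant′-translates-drop-first :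
    ∀ {n} (D : Fin (suc n) → Subset 𝒜) → Drifting 𝒜 (D zero) → (L : Fin (suc n) → List Carrier) →
    QuasiInvariant′ (Translates D L) → ∃ λ L′ → QuasiInvariant′ (Translates (λ i → D (suc i)) L′)
  quasiInvariant′-translates-drop-first D drifting L qi
    with quasiInvariant′-drop-drifting drifting (L zero) (quasiInvariant′-mono split qi)
    where
    split : Translates D L ⊆ L zero ⋆ D zero ∪ Translates (λ i → D (suc i)) (λ i → L (suc i))
    split (zero  , p∈) = inj₁ p∈
    split (suc i , p∈) = inj₂ (i , p∈)
  ... | g , qi′ = (λ i → cartesianProductWith _∙_ V (L (suc i))) ,
                  quasiInvariant′-mono (λ p∈ → ⋆-Translates V (∪-⋆⊆∷-⋆ _ p∈)) qi′
    where
    V : List Carrier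
    V = ε ∷ map (_∙ g ⁻¹) (L zero)

  translates-¬quasiInvariant′ :
    ∀ n (D : Fin n → Subset 𝒜) → (∀ i → Drifting 𝒜 (D i)) →
    (L : Fin n → List Carrier) → ¬ QuasiInvariant′ (Translates D L)
  translates-¬quasiInvariant′ zero D drifting L qi with quasiInvariant′⇒satisfiable qi
  ... | _ , () , _
  translates-¬quasiInvariant′ (suc n) D drifting L qi
    with quasiInvariant′-translates-drop-first D (drifting zero) L qi
  ... | L′ , qi′ = translates-¬quasiInvariant′ n (λ i → D (suc i)) (λ i → drifting (suc i)) L′ qi′

  ⋃⊆Translates-ε : ∀ {n} (D : Fin n → Subset 𝒜) → ⋃ 𝒜 D ⊆ Translates D (λ _ → ε ∷ [])
  ⋃⊆Translates-ε D (i , Dp) = i , ·⊆⋆ (here refl) (·-ε⁺ Dp)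

lemma4 : {c ℓ x : Level} (G : Group c ℓ) (𝒜 : Action G x)
         (n : ℕ) (D : Fin n → Subset 𝒜) →
         ((i : Fin n) → Drifting 𝒜 (D i)) →
         ¬ QuasiInvariant 𝒜 (⋃ 𝒜 D)
lemma4 G 𝒜 n D drifting qi =
  translates-¬quasiInvariant′ 𝒜 n D drifting (λ _ → ε ∷ [])
    (quasiInvariant′-mono 𝒜 (⋃⊆Translates-ε 𝒜 D) (quasiInvariant⇒quasiInvariant′ 𝒜 qi))
  where open Group G using (ε)
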